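{- Let $n\ge2$ and $a,b\in\{0,1\}$ with $a+n\equiv b\pmod 2$, and assume that not ($n=2$ and $a=b=1$). Then there exists $m>n$ such that $V_c\,\mathrm{Alt}_{n,ab}\cap V_c\,\mathrm{Alt}_{m,ab}\ne\emptyset$; in particular $V_c\,\mathrm{Alt}_{n,ab}\not\subseteq\mathrm{Alt}_{\le n}$.
   Context: A Boolean function is $f\colon\{0,1\}^n\to\{0,1\}$. For sets $I,J$ of Boolean functions, $IJ:=\{f(g_1,\dots,g_n): f\in I\ n\text{ -ary},\ g_i\in J \text{ all } m\text{ -ary}\}$. $V_c$ is the clone generated by binary disjunction $\vee$. The alternation number $\mathrm{Alt}(f)$ of an $r$-ary $f$ is the largest $d\ge0$ with $\mathbf a_0<\dots<\mathbf a_d$ in $\{0,1\}^r$ (componentwise) and $f(\mathbf a_i)\ne f(\mathbf a_{i+1})$ for all $i<d$. $\mathrm{Alt}_{k,ab}=\{f:\mathrm{Alt}(f)=k,\ f(0,\dots,0)=a,\ f(1,\dots,1)=b\}$, $\mathrm{Alt}_{\le n}=\{f:\mathrm{Alt}(f)\le n\}$. -}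

module Defs where

open import Data.Nat using (ℕ; zero; suc; _≤_; _<_)
open import Data.Bool using (Bool; true; false; _∨_)
open import Data.Fin using (Fin; inject₁) renaming (suc to fsuc)
open import Data.Vec using (Vec; lookup; tabulate; replicate)
open import Data.Unit using (⊤)
open import Data.Empty using (⊥)
open import Data.Product using (Σ; ∃; _×_; _,_)
open import Relation.Binary.PropositionalEquality using (_≡_; _≢_)

BoolFun : ℕ → Set
BoolFun r = Vec Bool r → Bool

b2n : Bool → ℕ
b2n false = 0
b2n true  = 1

_≤ᵇ_ : Bool → Bool → Set
false ≤ᵇ _     = ⊤
true  ≤ᵇ false = ⊥
true  ≤ᵇ true  = ⊤

_≤ᵛ_ : ∀ {r} → Vec Bool r → Vec Bool r → Set
_≤ᵛ_ {r} u v = (i : Fin r) → lookup u i ≤ᵇ lookup v i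

_<ᵛ_ : ∀ {r} → Vec Bool r → Vec Bool r → Set
u <ᵛ v = (u ≤ᵛ v) × (u ≢ v)

AltChain : ∀ {r} → BoolFun r → ℕ → Set
AltChain {r} f d =
  Σ (Fin (suc d) → Vec Bool r) λ a →
    (i : Fin d) → (a (inject₁ i) <ᵛ a (fsuc i)) × (f (a (inject₁ i)) ≢ f (a (fsuc i)))

AltIs : ∀ {r} → BoolFun r → ℕ → Set
AltIs f k = AltChain f k × (∀ d → AltChain f d → d ≤ k)

AltLe : ∀ {r} → BoolFun r → ℕ → Set
AltLe f n = ∀ d → AltChain f d → d ≤ n

InAlt : ℕ → Bool → Bool → ∀ {r} → BoolFun r → Set
InAlt k a b {r} f = AltIs f k × (f (replicate r false) ≡ a) × (f (replicate r true) ≡ b)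

-- Terms over binary disjunction in ℓ variables; V_c (the clone generated by ∨)
-- consists of the functions represented by such terms (projections closed
-- under composition with ∨).
data OrTerm (ℓ : ℕ) : Set where
  var : Fin ℓ → OrTerm ℓ
  or  : OrTerm ℓ → OrTerm ℓ → OrTerm ℓ

evalOr : ∀ {ℓ} → OrTerm ℓ → BoolFun ℓ
evalOr (var i)  x = lookup x i
evalOr (or s t) x = evalOr s x ∨ evalOr t x

InVc : ∀ {ℓ} → BoolFun ℓ → Set
InVc {ℓ} f = Σ (OrTerm ℓ) λ t → ∀ x → evalOr t x ≡ f x

InVcAlt : ℕ → Bool → Bool → ∀ {p} → BoolFun p → Set
InVcAlt k a b {p} h =
  Σ ℕ λ ℓ → Σ (BoolFun ℓ) λ f → Σ (Fin ℓ → BoolFun p) λ g →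
    InVc f × ((i : Fin ℓ) → InAlt k a b (g i)) ×
    (∀ x → h x ≡ f (tabulate (λ i → g i x)))

{-# OPTIONS --safe #-}
-- Let h = a ⊕ x₁ ⊕ … ⊕ x_{n+2}. A symmetric function x ↦ a ⊕ (s(|x|) mod 2) with monotone
-- weight profile s has alternation number s(n+2), since s(|x|) must strictly increase at every
-- alternation of a chain; so h ∈ Alt_{n+2,ab}. For c ≤ n let g_c have the profile
-- 0, …, c, c, c, c+1, …, n, i.e. h with the alternations at weights c+1, c+2 removed; then
-- g_c ∈ Alt_{n,ab}, and g_c differs from h only at weight c+1, where it equals ¬ h. Hence if h
-- is 1 at weights c₁+1 and c₂+1 for distinct c₁, c₂ ≤ n, then h = g_{c₁} ∨ g_{c₂} ∈ V_c Alt_{n,ab}.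
-- The least and the greatest such c, namely a and n − b, differ unless n = 2 and a = b = 1.
module Submission where

open import Defs
open import Data.Nat using (ℕ; zero; suc; _≤_; _<_; _+_; _∸_; _%_; z≤n; s≤s; _≟_)
open import Data.Nat.Properties
  using ( ≤-refl; ≤-trans; <⇒≤; <⇒≢; <⇒≱; ≤∧≢⇒<; +-mono-≤; +-monoʳ-≤; +-suc; m≤m+n
        ; n<1+n; n≤1+n; m∸n≤m; suc-injective; module ≤-Reasoning)
open import Data.Bool using (Bool; true; false; not; _∨_)
open import Data.Bool.Properties using (not-¬; not-involutive; ∨-idem; ∨-zeroʳ)
open import Data.Fin using (Fin; toℕ; fromℕ; inject₁) renaming (zero to fzero; suc to fsuc)
open import Data.Fin.Properties using (toℕ-inject₁; toℕ<n)
open import Data.Vec using (Vec; []; _∷_; lookup; replicate)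
open import Data.Product using (Σ; _×_; _,_; proj₁)
open import Data.Unit using (tt)
open import Data.Empty using (⊥-elim)
open import Function using (id; _∘_)
open import Relation.Binary.Core using (_Preserves_⟶_)
open import Relation.Binary.PropositionalEquality
  using (_≡_; _≢_; refl; sym; trans; cong; cong₂; subst; module ≡-Reasoning)
open import Relation.Nullary using (¬_; yes; no)

alternating : Bool → ℕ → Bool
alternating a zero    = a
alternating a (suc k) = not (alternating a k)

alternating-suc≢ : ∀ a k → alternating a k ≢ alternating a (suc k)
alternating-suc≢ a k = not-¬ refl

alternating-true : ∀ k → alternating true k ≡ alternating false (suc k)
alternating-true zero    = refl
alternating-true (suc k) = cong not (alternating-true k)

b2n-alternating-false : ∀ k → b2n (alternating false k) ≡ k % 2
b2n-alternating-false zero          = refl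
b2n-alternating-false (suc zero)    = refl
b2n-alternating-false (suc (suc k)) =
  trans (cong b2n (not-involutive (alternating false k))) (b2n-alternating-false k)

b2n-alternating : ∀ a k → b2n (alternating a k) ≡ (b2n a + k) % 2
b2n-alternating false k = b2n-alternating-false k
b2n-alternating true  k = trans (cong b2n (alternating-true k)) (b2n-alternating-false (suc k))

b2n-injective : ∀ {x y} → b2n x ≡ b2n y → x ≡ y
b2n-injective {false} {false} _ = refl
b2n-injective {true}  {true}  _ = refl

alternating-parity : ∀ a {b} n → (b2n a + n) % 2 ≡ b2n b → alternating a n ≡ b
alternating-parity a n par = b2n-injective (trans (b2n-alternating a n) par)

b2n≤1 : ∀ x → b2n x ≤ 1
b2n≤1 false = z≤n
b2n≤1 true  = ≤-refl

b2n-mono : ∀ {x y} → x ≤ᵇ y → b2n x ≤ b2n y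
b2n-mono {false}        _ = z≤n
b2n-mono {true}  {true} _ = ≤-refl

weight : ∀ {p} → Vec Bool p → ℕ
weight []       = 0
weight (x ∷ xs) = b2n x + weight xs

weight-mono : ∀ {p} {x y : Vec Bool p} → x ≤ᵛ y → weight x ≤ weight y
weight-mono {x = []}     {[]}     _   = ≤-refl
weight-mono {x = x ∷ xs} {y ∷ ys} x≤y =
  +-mono-≤ (b2n-mono (x≤y fzero)) (weight-mono {x = xs} {ys} (x≤y ∘ fsuc))

weight≤length : ∀ {p} (x : Vec Bool p) → weight x ≤ p
weight≤length []       = ≤-refl
weight≤length (x ∷ xs) = +-mono-≤ (b2n≤1 x) (weight≤length xs)

weight-replicate-false : ∀ p → weight (replicate p false) ≡ 0
weight-replicate-false zero    = refl
weight-replicate-false (suc p) = weight-replicate-false p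

weight-replicate-true : ∀ p → weight (replicate p true) ≡ p
weight-replicate-true zero    = refl
weight-replicate-true (suc p) = cong suc (weight-replicate-true p)

ones : (p k : ℕ) → Vec Bool p
ones zero    _       = []
ones (suc p) zero    = false ∷ ones p zero
ones (suc p) (suc k) = true ∷ ones p k

weight-ones : ∀ {p k} → k ≤ p → weight (ones p k) ≡ k
weight-ones {zero}  {zero}  z≤n       = refl
weight-ones {suc p} {zero}  z≤n       = weight-ones {p} z≤n
weight-ones {suc p} {suc k} (s≤s k≤p) = cong suc (weight-ones k≤p)

ones-mono : ∀ p {k k′} → k ≤ k′ → ones p k ≤ᵛ ones p k′
ones-mono (suc p) {zero}           _          fzero    = tt
ones-mono (suc p) {zero}  {zero}   _          (fsuc i) = ones-mono p z≤n i
ones-mono (suc p) {zero}  {suc k′} _          (fsuc i) = ones-mono p z≤n i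
ones-mono (suc p) {suc k} {suc k′} (s≤s _)    fzero    = tt
ones-mono (suc p) {suc k} {suc k′} (s≤s k≤k′) (fsuc i) = ones-mono p k≤k′ i

ones-<ᵛ : ∀ {p k k′} → k < k′ → k′ ≤ p → ones p k <ᵛ ones p k′
ones-<ᵛ {p} {k} {k′} k<k′ k′≤p = ones-mono p (<⇒≤ k<k′) , λ eq → <⇒≢ k<k′ (begin
    k                  ≡⟨ sym (weight-ones (≤-trans (<⇒≤ k<k′) k′≤p)) ⟩
    weight (ones p k)  ≡⟨ cong weight eq ⟩
    weight (ones p k′) ≡⟨ weight-ones k′≤p ⟩
    k′                 ∎)
  where open ≡-Reasoning

AltStep : ∀ {r} → BoolFun r → Vec Bool r → Vec Bool r → Set
AltStep f x y = (x <ᵛ y) × (f x ≢ f y)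

altChain-fromSeq : ∀ {r d} {f : BoolFun r} (v : ℕ → Vec Bool r) →
  (∀ j → j < d → AltStep f (v j) (v (suc j))) → AltChain f d
altChain-fromSeq {d = d} {f} v step = v ∘ toℕ , link
  where
  link : (i : Fin d) → AltStep f (v (toℕ (inject₁ i))) (v (suc (toℕ i)))
  link i rewrite toℕ-inject₁ i = step (toℕ i) (toℕ<n i)

module _ {r} (f : BoolFun r) (W : Vec Bool r → ℕ)
         (W-increasing : ∀ {x y} → AltStep f x y → W x < W y) where

  altChain-potential : ∀ d (c : Fin (suc d) → Vec Bool r) →
    (∀ i → AltStep f (c (inject₁ i)) (c (fsuc i))) → d + W (c fzero) ≤ W (c (fromℕ d))
  altChain-potential zero    c steps = ≤-refl
  altChain-potential (suc d) c steps = begin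
    suc d + W (c fzero)       ≡⟨ sym (+-suc d _) ⟩
    d + suc (W (c fzero))     ≤⟨ +-monoʳ-≤ d (W-increasing (steps fzero)) ⟩
    d + W (c (fsuc fzero))    ≤⟨ altChain-potential d (c ∘ fsuc) (steps ∘ fsuc) ⟩
    W (c (fromℕ (suc d)))     ∎
    where open ≤-Reasoning

  altLe-byPotential : ∀ {K} → (∀ x → W x ≤ K) → AltLe f K
  altLe-byPotential W≤K d (c , steps) =
    ≤-trans (m≤m+n d _) (≤-trans (altChain-potential d c steps) (W≤K (c (fromℕ d))))

symFun : Bool → (ℕ → ℕ) → ∀ {p} → BoolFun p
symFun a s x = alternating a (s (weight x))

symFun-altLe : ∀ {p} a (s : ℕ → ℕ) → s Preserves _≤_ ⟶ _≤_ → AltLe (symFun a s {p}) (s p)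
symFun-altLe a s s-mono =
  altLe-byPotential (symFun a s) (s ∘ weight) increasing (s-mono ∘ weight≤length)
  where
  increasing : ∀ {x y} → AltStep (symFun a s) x y → s (weight x) < s (weight y)
  increasing {x} {y} ((x≤y , _) , fx≢fy) =
    ≤∧≢⇒< (s-mono (weight-mono {x = x} {y} x≤y)) (fx≢fy ∘ cong (alternating a))

symFun-altChain : ∀ {p K} a (s t : ℕ → ℕ) → (∀ j → s (t j) ≡ j) → (∀ j → t j < t (suc j)) →
  (∀ j → j ≤ K → t j ≤ p) → AltChain (symFun a s {p}) K
symFun-altChain {p} {K} a s t s∘t≗id t-increasing t≤p =
  altChain-fromSeq {f = symFun a s} (ones p ∘ t) step
  where
  value : ∀ j → j ≤ K → symFun a s (ones p (t j)) ≡ alternating a j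
  value j j≤K = cong (alternating a) (trans (cong s (weight-ones (t≤p j j≤K))) (s∘t≗id j))

  step : ∀ j → j < K → AltStep (symFun a s) (ones p (t j)) (ones p (t (suc j)))
  step j j<K = ones-<ᵛ (t-increasing j) (t≤p (suc j) j<K) , λ eq →
    alternating-suc≢ a j (trans (sym (value j (<⇒≤ j<K))) (trans eq (value (suc j) j<K)))

symFun-InAlt : ∀ {p K} a {b} (s t : ℕ → ℕ) → s Preserves _≤_ ⟶ _≤_ → s 0 ≡ 0 → s p ≡ K →
  alternating a K ≡ b → (∀ j → s (t j) ≡ j) → (∀ j → t j < t (suc j)) →
  (∀ j → j ≤ K → t j ≤ p) → InAlt K a b (symFun a s {p})
symFun-InAlt {p} a s t s-mono s0≡0 sp≡K aK≡b s∘t≗id t-increasing t≤p =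
  ( symFun-altChain a s t s∘t≗id t-increasing t≤p
  , subst (AltLe (symFun a s)) sp≡K (symFun-altLe a s s-mono)) ,
  cong (alternating a) (trans (cong s (weight-replicate-false p)) s0≡0) ,
  trans (cong (alternating a) (trans (cong s (weight-replicate-true p)) sp≡K)) aK≡b

-- squash c k is k for k ≤ c, c for k ∈ {c+1, c+2}, and k ∸ 2 beyond;
-- unsquash c is the section of it that skips c+1 and c+2.
squash : ℕ → ℕ → ℕ
squash zero    zero          = 0
squash zero    (suc zero)    = 0
squash zero    (suc (suc k)) = k
squash (suc c) zero          = 0
squash (suc c) (suc k)       = suc (squash c k)

unsquash : ℕ → ℕ → ℕ
unsquash zero    zero    = 0
unsquash zero    (suc j) = suc (suc (suc j))
unsquash (suc c) zero    = 0
unsquash (suc c) (suc j) = suc (unsquash c j)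

squash-zero : ∀ c → squash c 0 ≡ 0
squash-zero zero    = refl
squash-zero (suc c) = refl

squash-suc-suc : ∀ {c n} → c ≤ n → squash c (suc (suc n)) ≡ n
squash-suc-suc {zero}          _         = refl
squash-suc-suc {suc c} {suc n} (s≤s c≤n) = cong suc (squash-suc-suc c≤n)

squash-mono : ∀ c → squash c Preserves _≤_ ⟶ _≤_
squash-mono zero    {zero}                       _                = z≤n
squash-mono zero    {suc zero}                   _                = z≤n
squash-mono zero    {suc (suc k)} {suc (suc k′)} (s≤s (s≤s k≤k′)) = k≤k′
squash-mono (suc c) {zero}                       _                = z≤n
squash-mono (suc c) {suc k}       {suc k′}       (s≤s k≤k′)       = s≤s (squash-mono c k≤k′)

squash∘unsquash : ∀ c j → squash c (unsquash c j) ≡ j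
squash∘unsquash zero    zero    = refl
squash∘unsquash zero    (suc j) = refl
squash∘unsquash (suc c) zero    = refl
squash∘unsquash (suc c) (suc j) = cong suc (squash∘unsquash c j)

unsquash-increasing : ∀ c j → unsquash c j < unsquash c (suc j)
unsquash-increasing zero    zero    = s≤s z≤n
unsquash-increasing zero    (suc j) = n<1+n _
unsquash-increasing (suc c) zero    = s≤s z≤n
unsquash-increasing (suc c) (suc j) = s≤s (unsquash-increasing c j)

unsquash≤suc-suc : ∀ c j → unsquash c j ≤ suc (suc j)
unsquash≤suc-suc zero    zero    = z≤n
unsquash≤suc-suc zero    (suc j) = ≤-refl
unsquash≤suc-suc (suc c) zero    = z≤n
unsquash≤suc-suc (suc c) (suc j) = s≤s (unsquash≤suc-suc c j)

alternating-squash : ∀ a c {k} → k ≢ suc c → alternating a (squash c k) ≡ alternating a k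
alternating-squash a zero    {zero}        _    = refl
alternating-squash a zero    {suc zero}    k≢1  = ⊥-elim (k≢1 refl)
alternating-squash a zero    {suc (suc k)} _    = sym (not-involutive (alternating a k))
alternating-squash a (suc c) {zero}        _    = refl
alternating-squash a (suc c) {suc k}       k≢c  = cong not (alternating-squash a c (k≢c ∘ cong suc))

alternating-∨-squash : ∀ {a c₁ c₂} → c₁ ≢ c₂ →
  alternating a (suc c₁) ≡ true → alternating a (suc c₂) ≡ true →
  ∀ k → alternating a k ≡ alternating a (squash c₁ k) ∨ alternating a (squash c₂ k)
alternating-∨-squash {a} {c₁} {c₂} c₁≢c₂ true₁ true₂ k with k ≟ suc c₁ | k ≟ suc c₂
... | yes refl | _ = begin
  alternating a (suc c₁)                          ≡⟨ true₁ ⟩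
  true                                            ≡⟨ sym (∨-zeroʳ _) ⟩
  alternating a (squash c₁ (suc c₁)) ∨ true       ≡⟨ cong (_ ∨_) (sym (trans other true₁)) ⟩
  alternating a (squash c₁ (suc c₁)) ∨ alternating a (squash c₂ (suc c₁)) ∎
  where
  open ≡-Reasoning
  other : alternating a (squash c₂ (suc c₁)) ≡ alternating a (suc c₁)
  other = alternating-squash a c₂ (c₁≢c₂ ∘ suc-injective)
... | no k≢₁ | yes refl =
  trans true₂ (cong (_∨ _) (sym (trans (alternating-squash a c₁ k≢₁) true₂)))
... | no k≢₁ | no k≢₂ =
  sym (trans (cong₂ _∨_ (alternating-squash a c₁ k≢₁) (alternating-squash a c₂ k≢₂)) (∨-idem _))

alternating-suc-b2n : ∀ a → alternating a (suc (b2n a)) ≡ true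
alternating-suc-b2n false = refl
alternating-suc-b2n true  = refl

alternating-suc-∸-b2n : ∀ {a b n} → 1 ≤ n → alternating a n ≡ b →
  alternating a (suc (n ∸ b2n b)) ≡ true
alternating-suc-∸-b2n {b = false}             _ aₙ≡b = cong not aₙ≡b
alternating-suc-∸-b2n {b = true}  {n = suc n} _ aₙ≡b = aₙ≡b

b2n≢∸-b2n : ∀ {n} a b → 2 ≤ n → ¬ (n ≡ 2 × a ≡ true × b ≡ true) → b2n a ≢ n ∸ b2n b
b2n≢∸-b2n false false (s≤s (s≤s _)) _        ()
b2n≢∸-b2n false true  (s≤s (s≤s _)) _        ()
b2n≢∸-b2n true  false (s≤s (s≤s _)) _        ()
b2n≢∸-b2n true  true  (s≤s (s≤s _)) excluded refl = excluded (refl , refl , refl)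

InAlt⇒InVcAlt : ∀ {k a b p} {g : BoolFun p} → InAlt k a b g → InVcAlt k a b g
InAlt⇒InVcAlt {g = g} g∈ =
  1 , evalOr (var fzero) , (λ _ → g) , (var fzero , λ _ → refl) , (λ _ → g∈) , λ _ → refl

InVcAlt-∨ : ∀ {k a b p} {g₁ g₂ h : BoolFun p} → InAlt k a b g₁ → InAlt k a b g₂ →
  (∀ x → h x ≡ g₁ x ∨ g₂ x) → InVcAlt k a b h
InVcAlt-∨ {k} {a} {b} {p} {g₁} {g₂} g₁∈ g₂∈ h≡g₁∨g₂ =
  2 , evalOr disjunction , lookup (g₁ ∷ g₂ ∷ []) , (disjunction , λ _ → refl) , g∈ , h≡g₁∨g₂
  where
  disjunction : OrTerm 2
  disjunction = or (var fzero) (var (fsuc fzero))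

  g∈ : (i : Fin 2) → InAlt k a b (lookup (g₁ ∷ g₂ ∷ []) i)
  g∈ fzero        = g₁∈
  g∈ (fsuc fzero) = g₂∈

symFun-squash-InAlt : ∀ {n c} a {b} → c ≤ n → alternating a n ≡ b →
  InAlt n a b (symFun a (squash c) {suc (suc n)})
symFun-squash-InAlt {c = c} a c≤n aₙ≡b =
  symFun-InAlt a (squash c) (unsquash c) (squash-mono c) (squash-zero c) (squash-suc-suc c≤n) aₙ≡b
    (squash∘unsquash c) (unsquash-increasing c)
    (λ j j≤n → ≤-trans (unsquash≤suc-suc c j) (s≤s (s≤s j≤n)))

symFun-id-InAlt : ∀ {n} a {b} → alternating a n ≡ b →
  InAlt (suc (suc n)) a b (symFun a id {suc (suc n)})
symFun-id-InAlt a aₙ≡b =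
  symFun-InAlt a id id id refl refl (trans (not-involutive _) aₙ≡b) (λ _ → refl) n<1+n (λ _ j≤ → j≤)

lemma6p11 : (n : ℕ) (a b : Bool) → 2 ≤ n → (b2n a + n) % 2 ≡ b2n b →
    ¬ (n ≡ 2 × a ≡ true × b ≡ true) →
    (Σ ℕ λ m → n < m × (Σ ℕ λ p → Σ (BoolFun p) λ h → InVcAlt n a b h × InVcAlt m a b h))
    × ¬ (∀ p (h : BoolFun p) → InVcAlt n a b h → AltLe h n)
lemma6p11 n a b 2≤n par excluded =
  (2 + n , n<2+n , 2 + n , h , h∈VcAltₙ , InAlt⇒InVcAlt h∈Alt₂₊ₙ) ,
  λ altLe → <⇒≱ n<2+n (altLe (2 + n) h h∈VcAltₙ (2 + n) (proj₁ (proj₁ h∈Alt₂₊ₙ)))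
  where
  n<2+n : n < 2 + n
  n<2+n = s≤s (n≤1+n n)

  aₙ≡b : alternating a n ≡ b
  aₙ≡b = alternating-parity a n par

  h : BoolFun (2 + n)
  h = symFun a id

  h∈Alt₂₊ₙ : InAlt (2 + n) a b h
  h∈Alt₂₊ₙ = symFun-id-InAlt a aₙ≡b

  1≤n : 1 ≤ n
  1≤n = ≤-trans (s≤s z≤n) 2≤n

  c₁ c₂ : ℕ
  c₁ = b2n a
  c₂ = n ∸ b2n b

  h∈VcAltₙ : InVcAlt n a b h
  h∈VcAltₙ = InVcAlt-∨ {g₁ = symFun a (squash c₁)} {g₂ = symFun a (squash c₂)}
    (symFun-squash-InAlt a (≤-trans (b2n≤1 a) 1≤n) aₙ≡b)
    (symFun-squash-InAlt a (m∸n≤m n (b2n b)) aₙ≡b)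
    (alternating-∨-squash (b2n≢∸-b2n a b 2≤n excluded) (alternating-suc-b2n a)
       (alternating-suc-∸-b2n 1≤n aₙ≡b) ∘ weight)
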